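{- Let $T$ be the binary hierarchical decomposition tree constructed from a Räcke decomposition $R$ of $G$ as described in the context. Let $a,b$ be two nodes of $T$ such that $a$ is an ancestor of $b$, and let $q$ be the distance from $a$ to $b$ in $T$. Then $|S_b|\le (3/4)^{\lfloor q/2\rfloor}|S_a|$. In particular, $T$ has depth $O(\log n)$.
   Context: $G=(V,E)$ is a graph on $n$ vertices. A hierarchical decomposition of $V$ is a rooted tree whose nodes $i$ correspond to subsets $S_i\subseteq V$, the root corresponding to $V$, the sets of the children of a node partitioning the set of that node, and the leaves being the singletons $\{v\}$, $v\in V$. A Räcke decomposition $R$ of $G$ is (in particular) such a hierarchical decomposition that is well-balanced: $|S_j|\le \tfrac34|S_i|$ for every child $j$ of every node $i$ of $R$. The tree $T$ is obtained from $R$ by repeatedly applying the following step until every non-leaf node has exactly two children: choose a node $i$ with $p>2$ children $j_1,\dots,j_p$ and let $w(h)=|S_{j_h}|/|S_i|$. (a) If $w(h)>1/4$ for some $h$, make $j_h$ a child of $i$ and create a new second child $b$ of $i$ with $S_b=S_i\setminus S_{j_h}$, whose children are the other $p-1$ nodes $j_{h'}$, $h'\neq h$. (b) Otherwise, partition $\{j_1,\dots,j_p\}$ into two sets $A,B$ with $\sum_{j_h\in A}w(h)\in[1/4,3/4]$ and $\sum_{j_h\in B}w(h)\in[1/4,3/4]$, and create two new children $a,b$ of $i$ with $S_a=\bigcup_{j\in A}S_j$, $S_b=\bigcup_{j\in B}S_j$, the children of $a$ (resp. $b$) being the nodes of $A$ (resp. $B$). -}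

module Defs where

open import Data.Nat using (ℕ; zero; suc; _+_; _*_; _≤_; _<_; ⌊_/2⌋; _^_)
open import Data.Fin using (Fin)
open import Data.List using (List; []; _∷_; _++_; length; allFin)
open import Data.List.Relation.Unary.All using (All)
open import Data.List.Membership.Propositional using (_∈_)
open import Data.List.Relation.Binary.Permutation.Propositional using (_↭_)
open import Data.Product using (_×_)
open import Relation.Binary.Construct.Closure.ReflexiveTransitive using (Star)

-- The set S_i of a node is the set of vertices at the leaves below
-- it (this is forced by "children partition the parent's set, leaves are the
-- singletons").
data Tree (n : ℕ) : Set where
  leaf : Fin n → Tree n
  node : List (Tree n) → Tree n

module _ {n : ℕ} where

  mutual
    leaves : Tree n → List (Fin n)
    leaves (leaf v)  = v ∷ []
    leaves (node cs) = leavesL cs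

    leavesL : List (Tree n) → List (Fin n)
    leavesL []       = []
    leavesL (c ∷ cs) = leaves c ++ leavesL cs

  size : Tree n → ℕ
  size t = length (leaves t)

  sizeL : List (Tree n) → ℕ
  sizeL cs = length (leavesL cs)

  -- non-empty lists (parts of a partition are non-empty, and only leaves
  -- are childless)
  data NonEmptyList {A : Set} : List A → Set where
    nonempty : ∀ {x xs} → NonEmptyList (x ∷ xs)

  data WF : Tree n → Set where
    wf-leaf : ∀ {v} → WF (leaf v)
    wf-node : ∀ {cs} → NonEmptyList cs → All WF cs → WF (node cs)

  -- Hierarchical decomposition of V = Fin n: well-formed tree whose leaves
  -- list every vertex exactly once (so the root's set is V and the children
  -- of every node partition its set).
  HierDecomp : Tree n → Set
  HierDecomp t = WF t × (leaves t ↭ allFin n)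

  data WellBalanced : Tree n → Set where
    wb-leaf : ∀ {v} → WellBalanced (leaf v)
    wb-node : ∀ {cs} → All (λ c → 4 * size c ≤ 3 * sizeL cs) cs →
              All WellBalanced cs → WellBalanced (node cs)

  -- Räcke decomposition, only the well-balancedness part
  BalancedHierDecomp : Tree n → Set
  BalancedHierDecomp t = HierDecomp t × WellBalanced t

  mutual
    data Step : Tree n → Tree n → Set where
      step-a : ∀ {cs c rest} → 3 ≤ length cs → cs ↭ (c ∷ rest) →
               sizeL cs < 4 * size c →
               Step (node cs) (node (c ∷ node rest ∷ []))
      step-b : ∀ {cs as bs} → 3 ≤ length cs →
               All (λ c → 4 * size c ≤ sizeL cs) cs →
               cs ↭ (as ++ bs) →
               sizeL cs ≤ 4 * sizeL as → 4 * sizeL as ≤ 3 * sizeL cs →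
               sizeL cs ≤ 4 * sizeL bs → 4 * sizeL bs ≤ 3 * sizeL cs →
               Step (node cs) (node (node as ∷ node bs ∷ []))
      step-in : ∀ {cs cs'} → StepL cs cs' → Step (node cs) (node cs')

    data StepL : List (Tree n) → List (Tree n) → Set where
      here  : ∀ {c c' cs} → Step c c' → StepL (c ∷ cs) (c' ∷ cs)
      there : ∀ {c cs cs'} → StepL cs cs' → StepL (c ∷ cs) (c ∷ cs')

  Steps : Tree n → Tree n → Set
  Steps = Star Step

  data Binary : Tree n → Set where
    bin-leaf : ∀ {v} → Binary (leaf v)
    bin-node : ∀ {l r} → Binary l → Binary r → Binary (node (l ∷ r ∷ []))

  data Desc : ℕ → Tree n → Tree n → Set where
    here  : ∀ {t} → Desc 0 t t
    child : ∀ {q cs c s} → c ∈ cs → Desc q c s → Desc (suc q) (node cs) s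

-- Binarisation never removes a node of R: a step only inserts new nodes
-- between a node i and its children. Call a tree grand-balanced when every
-- grandchild of every node i has at most 3/4 of the size of i, and every
-- node with at least three children (not binarised yet) has locally balanced
-- children, as the nodes of R have. A well-balanced R is grand-balanced, and
-- every step preserves this: in case (a) the new grandchildren of i are the
-- children of j_h, of size at most (3/4)|S_{j_h}|, and the other children
-- j_{h'}, of total size below (3/4)|S_i| because w(h) > 1/4; the new node b
-- has grandchildren of size at most 3/4 of the j_{h'} by local balance. In
-- case (b) every new grandchild has weight at most 1/4. Hence sizes drop by
-- a factor 3/4 every two levels, and as the sets of T are non-empty, a node
-- at depth q satisfies (4/3)^⌊q/2⌋ ≤ n, i.e. q = O(log n).

{-# OPTIONS --safe #-}
module Submission where

open import Defs
open import Data.Nat using (ℕ; _+_; _*_; _≤_; ⌊_/2⌋; _^_)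
open import Data.Nat.Logarithm using (⌊log₂_⌋)
open import Data.Product using (_×_; ∃)

open import Data.Nat using (suc; _<_; _/_; _%_; z≤n; s≤s)
open import Data.Nat.Properties
open import Data.Nat.DivMod using (m≡m%n+[m/n]*n; m%n<n)
open import Data.Nat.Logarithm using (⌊log₂⌋-mono-≤; ⌊log₂[2^n]⌋≡n)
open import Data.Nat.ListAction using (sum)
open import Data.Nat.ListAction.Properties using (sum-++; sum-↭)
open import Data.Nat.Tactic.RingSolver using (solve-∀)
open import Data.List using (List; []; _∷_; _++_; length; map)
open import Data.List.Properties using (length-++; map-++; length-tabulate)
open import Data.List.Relation.Unary.All as All using (All; []; _∷_)
open import Data.List.Relation.Unary.All.Properties using (++⁻)
open import Data.List.Relation.Unary.Any using (here; there)
open import Data.List.Membership.Propositional using (_∈_)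
open import Data.List.Relation.Binary.Permutation.Propositional using (_↭_)
open import Data.List.Relation.Binary.Permutation.Propositional.Properties
  using (All-resp-↭; ↭-length; map⁺)
open import Data.Product using (_,_)
open import Relation.Binary.PropositionalEquality
  using (_≡_; refl; sym; trans; cong; cong₂; subst; module ≡-Reasoning)
open import Relation.Binary.Construct.Closure.ReflexiveTransitive using (ε; _◅_)

remainder-small : ∀ a b S → a + b ≤ S → S < 4 * a → 4 * b ≤ 3 * S
remainder-small a b S a+b≤S S<4a = <⇒≤ (+-cancelʳ-< S (4 * b) (3 * S) (begin-strict
  4 * b + S      <⟨ +-monoʳ-< (4 * b) S<4a ⟩
  4 * b + 4 * a  ≡⟨ +-comm (4 * b) (4 * a) ⟩
  4 * a + 4 * b  ≡⟨ *-distribˡ-+ 4 a b ⟨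
  4 * (a + b)    ≤⟨ *-monoʳ-≤ 4 a+b≤S ⟩
  S + 3 * S      ≡⟨ +-comm S (3 * S) ⟩
  3 * S + S      ∎))
  where open ≤-Reasoning

shrink-twice : ∀ x y z k → x * 4 ^ k ≤ 3 ^ k * y → 4 * y ≤ 3 * z →
               x * 4 ^ suc k ≤ 3 ^ suc k * z
shrink-twice x y z k x≤y y≤z = begin
  x * (4 * 4 ^ k)    ≡⟨ x*[4*y]≡4*[x*y] x (4 ^ k) ⟩
  4 * (x * 4 ^ k)    ≤⟨ *-monoʳ-≤ 4 x≤y ⟩
  4 * (3 ^ k * y)    ≡⟨ x*[4*y]≡4*[x*y] (3 ^ k) y ⟨
  3 ^ k * (4 * y)    ≤⟨ *-monoʳ-≤ (3 ^ k) y≤z ⟩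
  3 ^ k * (3 * z)    ≡⟨ x*[3*y]≡3*x*y (3 ^ k) z ⟩
  3 * 3 ^ k * z      ∎
  where
  open ≤-Reasoning
  x*[4*y]≡4*[x*y] : ∀ x y → x * (4 * y) ≡ 4 * (x * y)
  x*[4*y]≡4*[x*y] = solve-∀
  x*[3*y]≡3*x*y : ∀ x y → x * (3 * y) ≡ 3 * x * y
  x*[3*y]≡3*x*y = solve-∀

-- 4³ ≥ 2·3³ is where the base of the logarithm is gained.
3^[3j+e]*2^j≤4^[3j+e] : ∀ j e → 3 ^ (j * 3 + e) * 2 ^ j ≤ 4 ^ (j * 3 + e)
3^[3j+e]*2^j≤4^[3j+e] 0 e = ≤-trans (≤-reflexive (*-identityʳ (3 ^ e))) (^-monoˡ-≤ e (n≤1+n 3))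
3^[3j+e]*2^j≤4^[3j+e] (suc j) e = begin
  3 * (3 * (3 * 3 ^ m)) * (2 * 2 ^ j)  ≡⟨ regroup₃ (3 ^ m) (2 ^ j) ⟩
  54 * (3 ^ m * 2 ^ j)                 ≤⟨ *-mono-≤ (m≤m+n 54 10) (3^[3j+e]*2^j≤4^[3j+e] j e) ⟩
  64 * 4 ^ m                           ≡⟨ regroup₄ (4 ^ m) ⟩
  4 * (4 * (4 * 4 ^ m))                ∎
  where
  open ≤-Reasoning
  m = j * 3 + e
  regroup₃ : ∀ x y → 3 * (3 * (3 * x)) * (2 * y) ≡ 54 * (x * y)
  regroup₃ = solve-∀
  regroup₄ : ∀ x → 64 * x ≡ 4 * (4 * (4 * x))
  regroup₄ = solve-∀

3^m*2^[m/3]≤4^m : ∀ m → 3 ^ m * 2 ^ (m / 3) ≤ 4 ^ m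
3^m*2^[m/3]≤4^m m =
  subst (λ k → 3 ^ k * 2 ^ (m / 3) ≤ 4 ^ k) (sym m≡[m/3]*3+m%3)
    (3^[3j+e]*2^j≤4^[3j+e] (m / 3) (m % 3))
  where
  m≡[m/3]*3+m%3 : m ≡ m / 3 * 3 + m % 3
  m≡[m/3]*3+m%3 = trans (m≡m%n+[m/n]*n m 3) (+-comm (m % 3) (m / 3 * 3))

4^k≤3^k*N⇒k≤3⌊log₂N⌋+2 : ∀ k N → 4 ^ k ≤ 3 ^ k * N → k ≤ ⌊log₂ N ⌋ * 3 + 2
4^k≤3^k*N⇒k≤3⌊log₂N⌋+2 k N 4^k≤3^k*N = begin
  k                          ≡⟨ trans (m≡m%n+[m/n]*n k 3) (+-comm (k % 3) (k / 3 * 3)) ⟩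
  k / 3 * 3 + k % 3          ≤⟨ +-mono-≤ (*-monoˡ-≤ 3 k/3≤log₂N) (≤-pred (m%n<n k 3)) ⟩
  ⌊log₂ N ⌋ * 3 + 2          ∎
  where
  open ≤-Reasoning
  2^[k/3]≤N : 2 ^ (k / 3) ≤ N
  2^[k/3]≤N = *-cancelˡ-≤ (3 ^ k) {{m^n≢0 3 k}} (≤-trans (3^m*2^[m/3]≤4^m k) 4^k≤3^k*N)
  k/3≤log₂N : k / 3 ≤ ⌊log₂ N ⌋
  k/3≤log₂N = subst (_≤ ⌊log₂ N ⌋) (⌊log₂[2^n]⌋≡n (k / 3)) (⌊log₂⌋-mono-≤ 2^[k/3]≤N)

n≤1+⌊n/2⌋+⌊n/2⌋ : ∀ n → n ≤ suc (⌊ n /2⌋ + ⌊ n /2⌋)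
n≤1+⌊n/2⌋+⌊n/2⌋ 0             = z≤n
n≤1+⌊n/2⌋+⌊n/2⌋ 1             = s≤s z≤n
n≤1+⌊n/2⌋+⌊n/2⌋ (suc (suc n)) =
  s≤s (s≤s (≤-trans (n≤1+⌊n/2⌋+⌊n/2⌋ n) (≤-reflexive (sym (+-suc ⌊ n /2⌋ ⌊ n /2⌋)))))

depth-bound : ∀ q N → 4 ^ ⌊ q /2⌋ ≤ 3 ^ ⌊ q /2⌋ * N → q ≤ 6 * ⌊log₂ N ⌋ + 6
depth-bound q N 4^k≤3^k*N = begin
  q                                ≤⟨ n≤1+⌊n/2⌋+⌊n/2⌋ q ⟩
  suc (k + k)                      ≤⟨ s≤s (+-mono-≤ k≤ k≤) ⟩
  1 + ((L * 3 + 2) + (L * 3 + 2))  ≤⟨ n≤1+n _ ⟩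
  2 + ((L * 3 + 2) + (L * 3 + 2))  ≡⟨ collect L ⟩
  6 * L + 6                        ∎
  where
  open ≤-Reasoning
  k = ⌊ q /2⌋
  L = ⌊log₂ N ⌋
  k≤ : k ≤ L * 3 + 2
  k≤ = 4^k≤3^k*N⇒k≤3⌊log₂N⌋+2 k N 4^k≤3^k*N
  collect : ∀ L → 2 + ((L * 3 + 2) + (L * 3 + 2)) ≡ 6 * L + 6
  collect = solve-∀

module _ {n : ℕ} where

  children : Tree n → List (Tree n)
  children (leaf _)  = []
  children (node cs) = cs

  sizeL-∷ : ∀ (c : Tree n) cs → sizeL (c ∷ cs) ≡ size c + sizeL cs
  sizeL-∷ c cs = length-++ (leaves c)

  sizeL-pair : ∀ (l r : Tree n) → sizeL (l ∷ r ∷ []) ≡ size l + size r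
  sizeL-pair l r = trans (sizeL-∷ l (r ∷ [])) (cong (size l +_) (trans (sizeL-∷ r []) (+-identityʳ (size r))))

  sizeL≡sum-map-size : ∀ (cs : List (Tree n)) → sizeL cs ≡ sum (map size cs)
  sizeL≡sum-map-size []       = refl
  sizeL≡sum-map-size (c ∷ cs) = trans (sizeL-∷ c cs) (cong (size c +_) (sizeL≡sum-map-size cs))

  sizeL-++ : ∀ (as bs : List (Tree n)) → sizeL (as ++ bs) ≡ sizeL as + sizeL bs
  sizeL-++ as bs = begin
    sizeL (as ++ bs)                       ≡⟨ sizeL≡sum-map-size (as ++ bs) ⟩
    sum (map size (as ++ bs))              ≡⟨ cong sum (map-++ size as bs) ⟩
    sum (map size as ++ map size bs)       ≡⟨ sum-++ (map size as) (map size bs) ⟩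
    sum (map size as) + sum (map size bs)  ≡⟨ cong₂ _+_ (sizeL≡sum-map-size as) (sizeL≡sum-map-size bs) ⟨
    sizeL as + sizeL bs                    ∎
    where open ≡-Reasoning

  sizeL-↭ : ∀ {cs ds : List (Tree n)} → cs ↭ ds → sizeL cs ≡ sizeL ds
  sizeL-↭ {cs} {ds} p = begin
    sizeL cs            ≡⟨ sizeL≡sum-map-size cs ⟩
    sum (map size cs)   ≡⟨ sum-↭ (map⁺ size p) ⟩
    sum (map size ds)   ≡⟨ sizeL≡sum-map-size ds ⟨
    sizeL ds            ∎
    where open ≡-Reasoning

  sizeL-↭-∷ : ∀ {cs c rest} → cs ↭ c ∷ rest → sizeL cs ≡ size c + sizeL rest
  sizeL-↭-∷ {c = c} {rest} p = trans (sizeL-↭ p) (sizeL-∷ c rest)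

  sizeL-↭-++ : ∀ {cs as bs} → cs ↭ as ++ bs → sizeL cs ≡ sizeL as + sizeL bs
  sizeL-↭-++ {as = as} {bs} p = trans (sizeL-↭ p) (sizeL-++ as bs)

  ∈⇒size≤sizeL : ∀ {c : Tree n} {cs} → c ∈ cs → size c ≤ sizeL cs
  ∈⇒size≤sizeL {c} {cs = _ ∷ cs} (here refl) =
    ≤-trans (m≤m+n (size c) (sizeL cs)) (≤-reflexive (sym (sizeL-∷ c cs)))
  ∈⇒size≤sizeL {c} {cs = d ∷ cs} (there c∈cs) =
    ≤-trans (≤-trans (∈⇒size≤sizeL c∈cs) (m≤n+m (sizeL cs) (size d))) (≤-reflexive (sym (sizeL-∷ d cs)))

  mutual
    step-size : ∀ {x x'} → Step x x' → size x' ≡ size x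
    step-size (step-a {c = c} {rest} _ p _)  = trans (sizeL-pair c (node rest)) (sym (sizeL-↭-∷ p))
    step-size (step-b {as = as} {bs} _ _ p _ _ _ _) = trans (sizeL-pair (node as) (node bs)) (sym (sizeL-↭-++ {as = as} p))
    step-size (step-in s)                    = stepL-size s

    stepL-size : ∀ {cs cs'} → StepL cs cs' → sizeL cs' ≡ sizeL cs
    stepL-size (here {c} {c'} {cs} s) =
      trans (sizeL-∷ c' cs) (trans (cong (_+ sizeL cs) (step-size s)) (sym (sizeL-∷ c cs)))
    stepL-size (there {c} {cs} {cs'} s) =
      trans (sizeL-∷ c cs') (trans (cong (size c +_) (stepL-size s)) (sym (sizeL-∷ c cs)))

  steps-size : ∀ {x y} → Steps x y → size y ≡ size x
  steps-size ε        = refl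
  steps-size (s ◅ ss) = trans (steps-size ss) (step-size s)

  stepL-length : ∀ {cs cs' : List (Tree n)} → StepL cs cs' → length cs' ≡ length cs
  stepL-length (here _)  = refl
  stepL-length (there s) = cong suc (stepL-length s)

  stepL-All : ∀ {P : Tree n → Set} → (∀ {y y'} → Step y y' → P y → P y') →
              ∀ {cs cs'} → StepL cs cs' → All P cs → All P cs'
  stepL-All f (here s)  (p ∷ ps) = f s p ∷ ps
  stepL-All f (there s) (p ∷ ps) = p ∷ stepL-All f s ps

  ChildrenBelow : ℕ → Tree n → Set
  ChildrenBelow B y = All (λ z → 4 * size z ≤ B) (children y)

  LocallyBalanced : Tree n → Set
  LocallyBalanced y = ChildrenBelow (3 * size y) y

  ChildrenBelow-weaken : ∀ {B B' y} → B ≤ B' → ChildrenBelow B y → ChildrenBelow B' y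
  ChildrenBelow-weaken B≤B' = All.map (λ h → ≤-trans h B≤B')

  step-ChildrenBelow : ∀ {x x' B} → Step x x' → 3 * size x ≤ B → ChildrenBelow B x → ChildrenBelow B x'
  step-ChildrenBelow (step-a {cs} {c} {rest} _ p big) 3x≤B below
    with All-resp-↭ p below
  ... | c-below ∷ _ = c-below ∷ ≤-trans rest-small 3x≤B ∷ []
    where
    rest-small : 4 * sizeL rest ≤ 3 * sizeL cs
    rest-small = remainder-small (size c) (sizeL rest) (sizeL cs) (≤-reflexive (sym (sizeL-↭-∷ p))) big
  step-ChildrenBelow (step-b _ _ _ _ 4a≤3x _ 4b≤3x) 3x≤B _ = ≤-trans 4a≤3x 3x≤B ∷ ≤-trans 4b≤3x 3x≤B ∷ []
  step-ChildrenBelow {B = B} (step-in s) _ below =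
    stepL-All (λ st → subst (λ k → 4 * k ≤ B) (sym (step-size st))) s below

  step-LocallyBalanced : ∀ {x x'} → Step x x' → LocallyBalanced x → LocallyBalanced x'
  step-LocallyBalanced {x' = x'} s balanced =
    ChildrenBelow-weaken {y = x'} (≤-reflexive (cong (3 *_) (sym (step-size s)))) (step-ChildrenBelow s ≤-refl balanced)

  stepL-ChildrenBelow : ∀ {cs cs' B} → StepL cs cs' → 3 * sizeL cs ≤ B →
                        All (ChildrenBelow B) cs → All (ChildrenBelow B) cs'
  stepL-ChildrenBelow (here {c} {_} {cs} s) 3S≤B (below ∷ belows) =
    step-ChildrenBelow s (≤-trans (*-monoʳ-≤ 3 (∈⇒size≤sizeL {cs = c ∷ cs} (here refl))) 3S≤B) below ∷ belows
  stepL-ChildrenBelow (there {c} {cs} s) 3S≤B (below ∷ belows) =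
    below ∷ stepL-ChildrenBelow s (≤-trans (*-monoʳ-≤ 3 sizeL-cs≤) 3S≤B) belows
    where
    sizeL-cs≤ : sizeL cs ≤ sizeL (c ∷ cs)
    sizeL-cs≤ = ≤-trans (m≤n+m (sizeL cs) (size c)) (≤-reflexive (sym (sizeL-∷ c cs)))

  -- The second field holds for the nodes of R, and a node keeps three or
  -- more children only as long as no step has been applied to it.
  data GrandBalanced : Tree n → Set where
    gb-leaf : ∀ {v} → GrandBalanced (leaf v)
    gb-node : ∀ {cs} → All (ChildrenBelow (3 * sizeL cs)) cs →
              (3 ≤ length cs → All LocallyBalanced cs) →
              All GrandBalanced cs → GrandBalanced (node cs)

  GrandBalanced-node : ∀ {cs} → All LocallyBalanced cs → All GrandBalanced cs → GrandBalanced (node cs)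
  GrandBalanced-node balanced grand =
    gb-node (All.tabulate (λ {c} c∈cs → ChildrenBelow-weaken {y = c} (*-monoʳ-≤ 3 (∈⇒size≤sizeL c∈cs))
                                                        (All.lookup balanced c∈cs)))
            (λ _ → balanced) grand

  GrandBalanced-pair : ∀ {l r S} → size l + size r ≡ S →
                       ChildrenBelow (3 * S) l → ChildrenBelow (3 * S) r →
                       GrandBalanced l → GrandBalanced r → GrandBalanced (node (l ∷ r ∷ []))
  GrandBalanced-pair {l} {r} size≡S below-l below-r grand-l grand-r =
    gb-node (subst (λ k → All (ChildrenBelow (3 * k)) (l ∷ r ∷ [])) (sym (trans (sizeL-pair l r) size≡S))
                   (below-l ∷ below-r ∷ []))
            (λ { (s≤s (s≤s ())) })
            (grand-l ∷ grand-r ∷ [])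

  step-a-GrandBalanced : ∀ {cs c rest} → cs ↭ c ∷ rest → sizeL cs < 4 * size c →
                         All (ChildrenBelow (3 * sizeL cs)) cs → All LocallyBalanced cs →
                         All GrandBalanced cs → GrandBalanced (node (c ∷ node rest ∷ []))
  step-a-GrandBalanced {cs} {c} {rest} p big below balanced grand
    with All-resp-↭ p below | All-resp-↭ p balanced | All-resp-↭ p grand
  ... | c-below ∷ _ | _ ∷ rest-balanced | c-grand ∷ rest-grand =
    GrandBalanced-pair (sym (sizeL-↭-∷ p)) c-below
      (All.tabulate (λ r∈rest → ≤-trans (*-monoʳ-≤ 4 (∈⇒size≤sizeL r∈rest)) rest-small))
      c-grand (GrandBalanced-node rest-balanced rest-grand)
    where
    rest-small : 4 * sizeL rest ≤ 3 * sizeL cs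
    rest-small = remainder-small (size c) (sizeL rest) (sizeL cs) (≤-reflexive (sym (sizeL-↭-∷ p))) big

  step-b-GrandBalanced : ∀ {cs as bs} → cs ↭ as ++ bs → All (λ c → 4 * size c ≤ sizeL cs) cs →
                         All LocallyBalanced cs → All GrandBalanced cs →
                         GrandBalanced (node (node as ∷ node bs ∷ []))
  step-b-GrandBalanced {cs} {as} {bs} p small balanced grand
    with ++⁻ as (All-resp-↭ p small) | ++⁻ as (All-resp-↭ p balanced) | ++⁻ as (All-resp-↭ p grand)
  ... | as-small , bs-small | as-balanced , bs-balanced | as-grand , bs-grand =
    GrandBalanced-pair (sym (sizeL-↭-++ {as = as} p))
      (ChildrenBelow-weaken {y = node as} S≤3S as-small) (ChildrenBelow-weaken {y = node bs} S≤3S bs-small)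
      (GrandBalanced-node as-balanced as-grand) (GrandBalanced-node bs-balanced bs-grand)
    where
    S≤3S : sizeL cs ≤ 3 * sizeL cs
    S≤3S = m≤m+n (sizeL cs) _

  mutual
    step-GrandBalanced : ∀ {x x'} → Step x x' → GrandBalanced x → GrandBalanced x'
    step-GrandBalanced (step-a 3≤p p big) (gb-node below balanced grand) =
      step-a-GrandBalanced p big below (balanced 3≤p) grand
    step-GrandBalanced (step-b 3≤p small p _ _ _ _) (gb-node _ balanced grand) =
      step-b-GrandBalanced p small (balanced 3≤p) grand
    step-GrandBalanced (step-in {cs} {cs'} s) (gb-node below balanced grand) =
      gb-node (subst (λ k → All (ChildrenBelow (3 * k)) cs') (sym (stepL-size s))
                     (stepL-ChildrenBelow s ≤-refl below))
              (λ 3≤p → stepL-All step-LocallyBalanced s (balanced (subst (3 ≤_) (stepL-length s) 3≤p)))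
              (stepL-GrandBalanced s grand)

    stepL-GrandBalanced : ∀ {cs cs'} → StepL cs cs' → All GrandBalanced cs → All GrandBalanced cs'
    stepL-GrandBalanced (here s)  (g ∷ gs) = step-GrandBalanced s g ∷ gs
    stepL-GrandBalanced (there s) (g ∷ gs) = g ∷ stepL-GrandBalanced s gs

  steps-GrandBalanced : ∀ {x y} → Steps x y → GrandBalanced x → GrandBalanced y
  steps-GrandBalanced ε        grand = grand
  steps-GrandBalanced (s ◅ ss) grand = steps-GrandBalanced ss (step-GrandBalanced s grand)

  WellBalanced⇒LocallyBalanced : ∀ {t} → WellBalanced t → LocallyBalanced t
  WellBalanced⇒LocallyBalanced wb-leaf          = []
  WellBalanced⇒LocallyBalanced (wb-node below _) = below

  mutual
    WellBalanced⇒GrandBalanced : ∀ {t} → WellBalanced t → GrandBalanced t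
    WellBalanced⇒GrandBalanced wb-leaf        = gb-leaf
    WellBalanced⇒GrandBalanced (wb-node _ wbs) =
      GrandBalanced-node (All.map WellBalanced⇒LocallyBalanced wbs) (All-WellBalanced⇒GrandBalanced wbs)

    All-WellBalanced⇒GrandBalanced : ∀ {cs} → All WellBalanced cs → All GrandBalanced cs
    All-WellBalanced⇒GrandBalanced []         = []
    All-WellBalanced⇒GrandBalanced (wb ∷ wbs) = WellBalanced⇒GrandBalanced wb ∷ All-WellBalanced⇒GrandBalanced wbs

  Desc-GrandBalanced : ∀ {q} {a b : Tree n} → Desc q a b → GrandBalanced a → GrandBalanced b
  Desc-GrandBalanced here              grand                = grand
  Desc-GrandBalanced (child c∈cs desc) (gb-node _ _ grands) = Desc-GrandBalanced desc (All.lookup grands c∈cs)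

  Desc-size : ∀ {q} {a b : Tree n} → GrandBalanced a → Desc q a b →
              size b * 4 ^ ⌊ q /2⌋ ≤ 3 ^ ⌊ q /2⌋ * size a
  Desc-size {a = a} _ here = ≤-reflexive (*-comm (size a) 1)
  Desc-size {b = b} _ (child c∈cs here) =
    ≤-trans (≤-reflexive (*-comm (size b) 1)) (*-monoʳ-≤ 1 (∈⇒size≤sizeL c∈cs))
  Desc-size {suc (suc q)} {node cs} {b} (gb-node below _ grands) (child {c = node ds} c∈cs (child {c = e} e∈ds desc))
    with All.lookup grands c∈cs
  ... | gb-node _ _ grands' =
    shrink-twice (size b) (size e) (sizeL cs) ⌊ q /2⌋
      (Desc-size (All.lookup grands' e∈ds) desc) (All.lookup (All.lookup below c∈cs) e∈ds)

  Desc-Binary : ∀ {q} {a b : Tree n} → Desc q a b → Binary a → Binary b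
  Desc-Binary here                             bin             = bin
  Desc-Binary (child (here refl) desc)         (bin-node l _)  = Desc-Binary desc l
  Desc-Binary (child (there (here refl)) desc) (bin-node _ r)  = Desc-Binary desc r
  Desc-Binary (child (there (there ())) _)     (bin-node _ _)

  Binary⇒1≤size : ∀ {t : Tree n} → Binary t → 1 ≤ size t
  Binary⇒1≤size bin-leaf                  = s≤s z≤n
  Binary⇒1≤size (bin-node {l} {r} bl _) =
    ≤-trans (≤-trans (Binary⇒1≤size bl) (m≤m+n (size l) (size r))) (≤-reflexive (sym (sizeL-pair l r)))

  binarisation-shrinks : ∀ {R T a b : Tree n} {r q} → BalancedHierDecomp R → Steps R T →
                         Desc r T a → Desc q a b → size b * 4 ^ ⌊ q /2⌋ ≤ 3 ^ ⌊ q /2⌋ * size a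
  binarisation-shrinks (_ , wb) steps T→a a→b =
    Desc-size (Desc-GrandBalanced T→a (steps-GrandBalanced steps (WellBalanced⇒GrandBalanced wb))) a→b

  binarisation-depth : ∀ {R T b : Tree n} {q} → BalancedHierDecomp R → Steps R T → Binary T →
                       Desc q T b → q ≤ 6 * ⌊log₂ n ⌋ + 6
  binarisation-depth {T = T} {b} {q} decomp@((_ , leaves↭) , _) steps bin T→b = depth-bound q n (begin
    4 ^ k               ≡⟨ *-identityˡ (4 ^ k) ⟨
    1 * 4 ^ k           ≤⟨ *-monoˡ-≤ (4 ^ k) (Binary⇒1≤size (Desc-Binary T→b bin)) ⟩
    size b * 4 ^ k      ≤⟨ binarisation-shrinks decomp steps here T→b ⟩
    3 ^ k * size T      ≡⟨ cong (3 ^ k *_) size-T ⟩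
    3 ^ k * n           ∎)
    where
    open ≤-Reasoning
    k = ⌊ q /2⌋
    size-T : size T ≡ n
    size-T = trans (steps-size steps) (trans (↭-length leaves↭) (length-tabulate (λ i → i)))

claim1 : ((n : ℕ) (R T : Tree n) → BalancedHierDecomp R → Steps R T → Binary T →
            (r q : ℕ) (a b : Tree n) → Desc r T a → Desc q a b →
            size b * 4 ^ ⌊ q /2⌋ ≤ 3 ^ ⌊ q /2⌋ * size a)
         × ∃ λ (c : ℕ) → (n : ℕ) (R T : Tree n) → BalancedHierDecomp R → Steps R T →
            Binary T → (q : ℕ) (b : Tree n) → Desc q T b → q ≤ c * ⌊log₂ n ⌋ + c
claim1 =
  (λ _ _ _ decomp steps _ _ _ _ _ T→a a→b → binarisation-shrinks decomp steps T→a a→b) ,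
  6 , (λ _ _ _ decomp steps bin _ _ T→b → binarisation-depth decomp steps bin T→b)
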